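{- For every integer $n\ge0$, $$P_n(x)=(2x)^n+(1-x)\sum_{j=0}^{n-1}\mathcal{B}(n-j-1,0)\,P_j(x)\,x^{n-j-1}.$$
   Context: For $0\le k\le n$ let $\mathcal{B}(n,k)=\binom{n}{\lfloor (n-k)/2\rfloor}$, so $\mathcal{B}(m,0)=\binom{m}{\lfloor m/2\rfloor}$, and let $P_n(x)=\sum_{k=0}^n\mathcal{B}(n,k)x^{n-k}$. -}

module Defs where

open import Level using (Level)
open import Data.Nat using (ℕ; zero; suc; _∸_; ⌊_/2⌋)
open import Data.Nat.Combinatorics using (_C_)
open import Data.Fin using (Fin; toℕ)
open import Algebra.Bundles using (CommutativeRing)
import Algebra.Properties.Semiring.Exp as Exp
import Algebra.Properties.Monoid.Mult as Mult
import Algebra.Properties.CommutativeMonoid.Sum as Sum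

𝓑 : ℕ → ℕ → ℕ
𝓑 n k = n C ⌊ n ∸ k /2⌋

module Poly {c ℓ : Level} (R : CommutativeRing c ℓ) where
  open CommutativeRing R
  open Exp semiring using (_^_)
  open Mult +-monoid using (_×_)
  open Sum +-commutativeMonoid using (sum)

  Σ< : (n : ℕ) → (ℕ → Carrier) → Carrier
  Σ< n f = sum {n} (λ (i : Fin n) → f (toℕ i))

  P : ℕ → Carrier → Carrier
  P n x = Σ< (suc n) (λ k → (𝓑 n k × 1#) * (x ^ (n ∸ k)))

  RHS : ℕ → Carrier → Carrier
  RHS n x = ((1# + 1#) * x) ^ n
          + (1# - x) * Σ< n (λ j → ((𝓑 (n ∸ j ∸ 1) 0 × 1#) * P j x) * (x ^ (n ∸ j ∸ 1)))

-- Both sides satisfy the recurrence Q₀ = 1, Q_{n+1} = (1 + x²) Q_n + 𝓑(n,0) x^{n+1} (1 − x).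
-- For P this is Pascal's rule, since P_n = Σ_{m ≤ n} C(n, ⌊m/2⌋) x^m.  For the right-hand side it
-- comes down to the convolution identity 𝓑(n,0) + Σ_{j<n} 𝓑(j,0) 𝓑(n−1−j,0) = 2ⁿ, which a parity
-- split reduces to the classical Σ_{a ≤ k} C(2a,a) C(2k−2a,k−a) = 4ᵏ.
module Submission where

open import Defs
open import Level using (Level)
open import Data.Nat using (ℕ; zero; suc)
open import Algebra.Bundles using (CommutativeRing)

open import Algebra.Bundles using (CommutativeSemiring)
open import Data.Fin using (toℕ)
import Data.Nat as ℕ
import Data.Nat.Properties as ℕₚ
import Relation.Binary.PropositionalEquality as ≡

-- For the semiring of a ring R, Σ< below is definitionally Poly.Σ< R.
module IndexedSum {c ℓ} (S : CommutativeSemiring c ℓ) where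

  open import Data.Nat using (_∸_; _<_; z<s; s<s)
  open CommutativeSemiring S
  open import Algebra.Properties.Semiring.Sum semiring using (sum; ∑-distrib-+; *-distribˡ-sum)
  open import Algebra.Properties.CommutativeSemigroup +-commutativeSemigroup using (interchange; xy∙z≈xz∙y)
  open import Relation.Binary.Reasoning.Setoid setoid

  Σ< : ℕ → (ℕ → Carrier) → Carrier
  Σ< n f = sum {n} (λ i → f (toℕ i))

  Σ<-cong : ∀ n {f g : ℕ → Carrier} → (∀ i → i < n → f i ≈ g i) → Σ< n f ≈ Σ< n g
  Σ<-cong zero    f≈g = refl
  Σ<-cong (suc n) f≈g = +-cong (f≈g 0 z<s) (Σ<-cong n (λ i i<n → f≈g (suc i) (s<s i<n)))

  Σ<-last : ∀ n f → Σ< (suc n) f ≈ Σ< n f + f n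
  Σ<-last zero    f = +-comm (f 0) 0#
  Σ<-last (suc n) f = trans (+-congˡ (Σ<-last n (λ i → f (suc i)))) (sym (+-assoc (f 0) _ _))

  Σ<-+ : ∀ n f g → Σ< n (λ i → f i + g i) ≈ Σ< n f + Σ< n g
  Σ<-+ n f g = ∑-distrib-+ {n} _ _

  Σ<-*ˡ : ∀ n a f → Σ< n (λ i → a * f i) ≈ a * Σ< n f
  Σ<-*ˡ n a f = sym (*-distribˡ-sum {n} a _)

  Σ<-*ˡ-cong : ∀ n a {f g : ℕ → Carrier} → (∀ i → i < n → a * f i ≈ g i) → a * Σ< n f ≈ Σ< n g
  Σ<-*ˡ-cong n a {f} af≈g = trans (sym (Σ<-*ˡ n a f)) (Σ<-cong n af≈g)

  Σ<-reverse : ∀ k f → Σ< (suc k) (λ i → f (k ∸ i)) ≈ Σ< (suc k) f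
  Σ<-reverse zero    f = refl
  Σ<-reverse (suc k) f = begin
    f (suc k) + Σ< (suc k) (λ i → f (k ∸ i)) ≈⟨ +-congˡ (Σ<-reverse k f) ⟩
    f (suc k) + Σ< (suc k) f                 ≈⟨ +-comm _ _ ⟩
    Σ< (suc k) f + f (suc k)                 ≈⟨ Σ<-last (suc k) f ⟨
    Σ< (suc (suc k)) f                       ∎

  Σ<-parity : ∀ k f → Σ< (k ℕ.+ k) f ≈ Σ< k (λ a → f (a ℕ.+ a)) + Σ< k (λ a → f (suc (a ℕ.+ a)))
  Σ<-parity zero    f = sym (+-identityʳ 0#)
  Σ<-parity (suc k) f = begin
    Σ< (suc k ℕ.+ suc k) f                        ≡⟨ ≡.cong (λ m → Σ< (suc m) f) (ℕₚ.+-suc k k) ⟩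
    f 0 + (f 1 + Σ< (k ℕ.+ k) (λ i → f (suc (suc i))))
                                                   ≈⟨ +-congˡ (+-congˡ (Σ<-parity k (λ i → f (suc (suc i))))) ⟩
    f 0 + (f 1 + (Σ< k evens + Σ< k odds))        ≈⟨ +-assoc _ _ _ ⟨
    (f 0 + f 1) + (Σ< k evens + Σ< k odds)        ≈⟨ interchange _ _ _ _ ⟩
    (f 0 + Σ< k evens) + (f 1 + Σ< k odds)        ≈⟨ +-cong (+-congˡ (Σ<-cong k (λ a _ → shift (λ m → f (suc m)) a)))
                                                            (+-congˡ (Σ<-cong k (λ a _ → shift (λ m → f (suc (suc m))) a))) ⟩
    Σ< (suc k) (λ a → f (a ℕ.+ a)) + Σ< (suc k) (λ a → f (suc (a ℕ.+ a))) ∎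
    where
    evens odds : ℕ → Carrier
    evens a = f (suc (suc (a ℕ.+ a)))
    odds a = f (suc (suc (suc (a ℕ.+ a))))
    shift : ∀ (g : ℕ → Carrier) a → g (suc (a ℕ.+ a)) ≈ g (a ℕ.+ suc a)
    shift g a = reflexive (≡.cong g (≡.sym (ℕₚ.+-suc a a)))

  Σ<-parity-suc : ∀ k f → Σ< (suc (k ℕ.+ k)) f ≈ Σ< (suc k) (λ a → f (a ℕ.+ a)) + Σ< k (λ a → f (suc (a ℕ.+ a)))
  Σ<-parity-suc k f = begin
    Σ< (suc (k ℕ.+ k)) f                                   ≈⟨ Σ<-last (k ℕ.+ k) f ⟩
    Σ< (k ℕ.+ k) f + f (k ℕ.+ k)                           ≈⟨ +-congʳ (Σ<-parity k f) ⟩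
    Σ< k (λ a → f (a ℕ.+ a)) + odds + f (k ℕ.+ k)          ≈⟨ xy∙z≈xz∙y _ _ _ ⟩
    Σ< k (λ a → f (a ℕ.+ a)) + f (k ℕ.+ k) + odds          ≈⟨ +-congʳ (Σ<-last k (λ a → f (a ℕ.+ a))) ⟨
    Σ< (suc k) (λ a → f (a ℕ.+ a)) + odds                  ∎
    where
    odds : Carrier
    odds = Σ< k (λ a → f (suc (a ℕ.+ a)))

module BinomialConvolution where

  open import Data.Nat
  open import Data.Nat.Properties
  open import Data.Nat.Combinatorics using (_C_; nCk+nC[k+1]≡[n+1]C[k+1]; nCk≡nC[n∸k]; nC1≡n)
  open import Data.Nat.Tactic.RingSolver using (solve-∀)
  open import Relation.Binary.PropositionalEquality
  open ≡-Reasoning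
  open import Algebra.Properties.CommutativeSemigroup *-commutativeSemigroup using (x∙yz≈y∙xz)
  open IndexedSum +-*-commutativeSemiring

  [1+k]*[1+n]C[1+k]≡[1+n]*nCk : ∀ n k → suc k * (suc n C suc k) ≡ suc n * (n C k)
  [1+k]*[1+n]C[1+k]≡[1+n]*nCk zero    zero    = refl
  [1+k]*[1+n]C[1+k]≡[1+n]*nCk zero    (suc k) = *-zeroʳ (suc (suc k))
  [1+k]*[1+n]C[1+k]≡[1+n]*nCk (suc n) zero    =
    trans (+-identityʳ _) (trans (nC1≡n (suc (suc n))) (sym (*-identityʳ (suc (suc n)))))
  [1+k]*[1+n]C[1+k]≡[1+n]*nCk (suc n) (suc k) = begin
    suc (suc k) * (suc (suc n) C suc (suc k))  ≡⟨ cong (suc (suc k) *_) (nCk+nC[k+1]≡[n+1]C[k+1] (suc n) (suc k)) ⟨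
    suc (suc k) * (A + B)                      ≡⟨ *-distribˡ-+ (suc (suc k)) A B ⟩
    A + suc k * A + suc (suc k) * B            ≡⟨ cong₂ (λ u v → A + u + v) ([1+k]*[1+n]C[1+k]≡[1+n]*nCk n k)
                                                                            ([1+k]*[1+n]C[1+k]≡[1+n]*nCk n (suc k)) ⟩
    A + suc n * (n C k) + suc n * (n C suc k)  ≡⟨ +-assoc A _ _ ⟩
    A + (suc n * (n C k) + suc n * (n C suc k)) ≡⟨ cong (A +_) (*-distribˡ-+ (suc n) (n C k) (n C suc k)) ⟨
    A + suc n * (n C k + n C suc k)            ≡⟨ cong (λ z → A + suc n * z) (nCk+nC[k+1]≡[n+1]C[k+1] n k) ⟩
    suc (suc n) * A                            ∎
    where
    A B : ℕ
    A = suc n C suc k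
    B = suc n C suc (suc k)

  𝓑-sym : ∀ n → n C ⌈ n /2⌉ ≡ 𝓑 n 0
  𝓑-sym n = trans (nCk≡nC[n∸k] (⌈n/2⌉≤n n))
    (cong (n C_) (trans (cong (_∸ ⌈ n /2⌉) (sym (⌊n/2⌋+⌈n/2⌉≡n n))) (m+n∸n≡m ⌊ n /2⌋ ⌈ n /2⌉)))

  central : ℕ → ℕ
  central a = (a + a) C a

  [1+2a]C[1+a]≡[1+2a]Ca : ∀ a → suc (a + a) C suc a ≡ suc (a + a) C a
  [1+2a]C[1+a]≡[1+2a]Ca a = trans (nCk≡nC[n∸k] (s≤s (m≤m+n a a))) (cong (suc (a + a) C_) (m+n∸m≡n a a))

  central-suc : ∀ a → central (suc a) ≡ 2 * (suc (a + a) C a)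
  central-suc a = begin
    (suc a + suc a) C suc a                    ≡⟨ cong (λ m → suc m C suc a) (+-suc a a) ⟩
    suc (suc (a + a)) C suc a                  ≡⟨ nCk+nC[k+1]≡[n+1]C[k+1] (suc (a + a)) a ⟨
    suc (a + a) C a + suc (a + a) C suc a      ≡⟨ cong (suc (a + a) C a +_) ([1+2a]C[1+a]≡[1+2a]Ca a) ⟩
    suc (a + a) C a + suc (a + a) C a          ≡⟨ cong (suc (a + a) C a +_) (+-identityʳ (suc (a + a) C a)) ⟨
    2 * (suc (a + a) C a)                      ∎

  central-rec : ∀ b → suc b * central (suc b) ≡ 2 * suc (b + b) * central b
  central-rec b = begin
    suc b * central (suc b)                    ≡⟨ cong (suc b *_) (central-suc b) ⟩
    suc b * (2 * (suc (b + b) C b))            ≡⟨ x∙yz≈y∙xz (suc b) 2 (suc (b + b) C b) ⟩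
    2 * (suc b * (suc (b + b) C b))            ≡⟨ cong (λ z → 2 * (suc b * z)) ([1+2a]C[1+a]≡[1+2a]Ca b) ⟨
    2 * (suc b * (suc (b + b) C suc b))        ≡⟨ cong (2 *_) ([1+k]*[1+n]C[1+k]≡[1+n]*nCk (b + b) b) ⟩
    2 * (suc (b + b) * central b)              ≡⟨ *-assoc 2 (suc (b + b)) (central b) ⟨
    2 * suc (b + b) * central b                ∎

  𝓑-even : ∀ a → 𝓑 (a + a) 0 ≡ central a
  𝓑-even a = cong ((a + a) C_) (sym (n≡⌊n+n/2⌋ a))

  𝓑-odd : ∀ a → 2 * 𝓑 (suc (a + a)) 0 ≡ central (suc a)
  𝓑-odd a = trans (cong (λ k → 2 * (suc (a + a) C k)) (sym (n≡⌈n+n/2⌉ a))) (sym (central-suc a))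

  -- Reversing a ↦ k ∸ a gives 2τ = kσ, and central-rec gives τ (k+1) = 4τ + 2σ;
  -- together (k+1) σ (k+1) = 4 (k+1) σ k.
  σ τ : ℕ → ℕ
  σ k = Σ< (suc k) (λ a → central a * central (k ∸ a))
  τ k = Σ< (suc k) (λ a → a * (central a * central (k ∸ a)))

  τ+τ≡k*σ : ∀ k → τ k + τ k ≡ k * σ k
  τ+τ≡k*σ k = begin
    τ k + τ k                                  ≡⟨ cong (τ k +_) (Σ<-reverse k f) ⟨
    τ k + Σ< (suc k) (λ a → f (k ∸ a))         ≡⟨ Σ<-+ (suc k) f (λ a → f (k ∸ a)) ⟨
    Σ< (suc k) (λ a → f a + f (k ∸ a))         ≡⟨ Σ<-cong (suc k) reflect ⟩
    Σ< (suc k) (λ a → k * g a)                 ≡⟨ Σ<-*ˡ (suc k) k g ⟩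
    k * σ k                                    ∎
    where
    g f : ℕ → ℕ
    g a = central a * central (k ∸ a)
    f a = a * g a
    reflect : ∀ a → a < suc k → f a + f (k ∸ a) ≡ k * g a
    reflect a (s≤s a≤k) = begin
      a * g a + (k ∸ a) * (central (k ∸ a) * central (k ∸ (k ∸ a)))
        ≡⟨ cong (λ b → a * g a + (k ∸ a) * (central (k ∸ a) * central b)) (m∸[m∸n]≡n a≤k) ⟩
      a * g a + (k ∸ a) * (central (k ∸ a) * central a)
        ≡⟨ cong (λ z → a * g a + (k ∸ a) * z) (*-comm (central (k ∸ a)) (central a)) ⟩
      a * g a + (k ∸ a) * g a                  ≡⟨ *-distribʳ-+ (g a) a (k ∸ a) ⟨
      (a + (k ∸ a)) * g a                      ≡⟨ cong (_* g a) (m+[n∸m]≡n a≤k) ⟩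
      k * g a                                  ∎

  τ-suc : ∀ k → τ (suc k) ≡ 4 * τ k + 2 * σ k
  τ-suc k = begin
    τ (suc k)                                            ≡⟨⟩
    Σ< (suc k) (λ b → suc b * (central (suc b) * central (k ∸ b)))
                                                         ≡⟨ Σ<-cong (suc k) (λ b _ → shift b) ⟩
    Σ< (suc k) (λ b → 4 * f b + 2 * g b)                 ≡⟨ Σ<-+ (suc k) (λ b → 4 * f b) (λ b → 2 * g b) ⟩
    Σ< (suc k) (λ b → 4 * f b) + Σ< (suc k) (λ b → 2 * g b)
                                                         ≡⟨ cong₂ _+_ (Σ<-*ˡ (suc k) 4 f) (Σ<-*ˡ (suc k) 2 g) ⟩
    4 * τ k + 2 * σ k                                    ∎
    where
    g f : ℕ → ℕ
    g b = central b * central (k ∸ b)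
    f b = b * g b
    shift : ∀ b → suc b * (central (suc b) * central (k ∸ b)) ≡ 4 * f b + 2 * g b
    shift b = begin
      suc b * (central (suc b) * central (k ∸ b))    ≡⟨ *-assoc (suc b) (central (suc b)) (central (k ∸ b)) ⟨
      suc b * central (suc b) * central (k ∸ b)      ≡⟨ cong (_* central (k ∸ b)) (central-rec b) ⟩
      2 * suc (b + b) * central b * central (k ∸ b)  ≡⟨ expand b (central b) (central (k ∸ b)) ⟩
      4 * f b + 2 * g b                              ∎
      where
      expand : ∀ b p q → 2 * suc (b + b) * p * q ≡ 4 * (b * (p * q)) + 2 * (p * q)
      expand = solve-∀

  σ-suc : ∀ k → σ (suc k) ≡ 4 * σ k
  σ-suc k = *-cancelˡ-≡ (σ (suc k)) (4 * σ k) (suc k) (begin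
    suc k * σ (suc k)                          ≡⟨ τ+τ≡k*σ (suc k) ⟨
    τ (suc k) + τ (suc k)                      ≡⟨ cong₂ _+_ (τ-suc k) (τ-suc k) ⟩
    (4 * τ k + 2 * σ k) + (4 * τ k + 2 * σ k)  ≡⟨ regroup (τ k) (σ k) ⟩
    4 * (τ k + τ k) + 4 * σ k                  ≡⟨ cong (λ z → 4 * z + 4 * σ k) (τ+τ≡k*σ k) ⟩
    4 * (k * σ k) + 4 * σ k                    ≡⟨ factor k (σ k) ⟩
    suc k * (4 * σ k)                          ∎)
    where
    regroup : ∀ t s → (4 * t + 2 * s) + (4 * t + 2 * s) ≡ 4 * (t + t) + 4 * s
    regroup = solve-∀
    factor : ∀ k s → 4 * (k * s) + 4 * s ≡ suc k * (4 * s)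
    factor = solve-∀

  σ≡4^k : ∀ k → σ k ≡ 4 ^ k
  σ≡4^k zero    = refl
  σ≡4^k (suc k) = trans (σ-suc k) (cong (4 *_) (σ≡4^k k))

  Σ<-last-central : ∀ k (u : ℕ → ℕ) →
                    Σ< (suc k) (λ a → u a * central (k ∸ a)) ≡ Σ< k (λ a → u a * central (k ∸ a)) + u k
  Σ<-last-central k u = trans (Σ<-last k (λ a → u a * central (k ∸ a)))
    (cong (Σ< k (λ a → u a * central (k ∸ a)) +_)
      (trans (cong (λ m → u k * central m) (n∸n≡0 k)) (*-identityʳ (u k))))

  σ-head : ∀ k → σ k ≡ central k + Σ< k (λ a → central (suc a) * central (k ∸ suc a))
  σ-head k = cong (_+ Σ< k (λ a → central (suc a) * central (k ∸ suc a))) (*-identityˡ (central k))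

  4^k≡2^[k+k] : ∀ k → 4 ^ k ≡ 2 ^ (k + k)
  4^k≡2^[k+k] k = trans (^-*-assoc 2 2 k) (cong (λ m → 2 ^ (k + m)) (+-identityʳ k))

  1+[k∸[1+a]]≡k∸a : ∀ {k a} → a < k → suc (k ∸ suc a) ≡ k ∸ a
  1+[k∸[1+a]]≡k∸a a<k = sym (+-∸-assoc 1 a<k)

  [k+k]∸[a+a]∸1 : ∀ {k a} → a < k → (k + k) ∸ (a + a) ∸ 1 ≡ suc ((k ∸ suc a) + (k ∸ suc a))
  [k+k]∸[a+a]∸1 {suc k} {zero}  _         = +-suc k k
  [k+k]∸[a+a]∸1 {suc k} {suc a} (s≤s a<k) =
    trans (cong (_∸ 1) (cong₂ _∸_ (+-suc k k) (+-suc a a))) ([k+k]∸[a+a]∸1 a<k)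

  [k+k]∸[1+a+a]∸1 : ∀ {k a} → a < k → (k + k) ∸ suc (a + a) ∸ 1 ≡ (k ∸ suc a) + (k ∸ suc a)
  [k+k]∸[1+a+a]∸1 {suc k} {zero}  _         = cong (_∸ 1) (+-suc k k)
  [k+k]∸[1+a+a]∸1 {suc k} {suc a} (s≤s a<k) =
    trans (cong (_∸ 1) (cong₂ _∸_ (+-suc k k) (cong suc (+-suc a a)))) ([k+k]∸[1+a+a]∸1 a<k)

  [1+k+k]∸[a+a]∸1 : ∀ {k a} → a ≤ k → suc (k + k) ∸ (a + a) ∸ 1 ≡ (k ∸ a) + (k ∸ a)
  [1+k+k]∸[a+a]∸1 {k}     {zero}  _         = refl
  [1+k+k]∸[a+a]∸1 {suc k} {suc a} (s≤s a≤k) =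
    trans (cong (_∸ 1) (cong₂ _∸_ (cong suc (+-suc k k)) (+-suc a a))) ([1+k+k]∸[a+a]∸1 a≤k)

  ∸-suc : ∀ m n → m ∸ n ∸ 1 ≡ m ∸ suc n
  ∸-suc m n = trans (∸-+-assoc m n 1) (cong (m ∸_) (+-comm n 1))

  𝓑-conv : ℕ → ℕ
  𝓑-conv n = Σ< n (λ j → 𝓑 j 0 * 𝓑 (n ∸ j ∸ 1) 0)

  𝓑+𝓑-conv-even : ∀ k → 𝓑 (k + k) 0 + 𝓑-conv (k + k) ≡ 2 ^ (k + k)
  𝓑+𝓑-conv-even k = *-cancelˡ-≡ _ _ 2 (begin
    2 * (𝓑 (k + k) 0 + 𝓑-conv (k + k))        ≡⟨ cong (λ z → 2 * (𝓑 (k + k) 0 + z)) (Σ<-parity k f) ⟩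
    2 * (𝓑 (k + k) 0 + (Σ< k evens + Σ< k odds)) ≡⟨ distribute (𝓑 (k + k) 0) (Σ< k evens) (Σ< k odds) ⟩
    2 * 𝓑 (k + k) 0 + (2 * Σ< k evens + 2 * Σ< k odds)
      ≡⟨ cong₂ (λ u v → 2 * u + v) (𝓑-even k)
           (cong₂ _+_ (Σ<-*ˡ-cong k 2 {evens} (λ a → even-term))
                      (Σ<-*ˡ-cong k 2 {odds} (λ a → odd-term))) ⟩
    2 * central k + (Σ< k front + Σ< k back)  ≡⟨ rearrange (central k) (Σ< k front) (Σ< k back) ⟩
    (Σ< k front + central k) + (central k + Σ< k back)
                                               ≡⟨ cong₂ _+_ (Σ<-last-central k central) (σ-head k) ⟨
    σ k + σ k                                  ≡⟨ cong (λ s → s + s) (trans (σ≡4^k k) (4^k≡2^[k+k] k)) ⟩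
    2 ^ (k + k) + 2 ^ (k + k)                  ≡⟨ cong (2 ^ (k + k) +_) (+-identityʳ (2 ^ (k + k))) ⟨
    2 * 2 ^ (k + k)                            ∎)
    where
    f : ℕ → ℕ
    f j = 𝓑 j 0 * 𝓑 ((k + k) ∸ j ∸ 1) 0
    evens odds front back : ℕ → ℕ
    evens a = f (a + a)
    odds a = f (suc (a + a))
    front a = central a * central (k ∸ a)
    back a = central (suc a) * central (k ∸ suc a)
    even-term : ∀ {a} → a < k → 2 * evens a ≡ front a
    even-term {a} a<k = begin
      2 * (𝓑 (a + a) 0 * 𝓑 ((k + k) ∸ (a + a) ∸ 1) 0) ≡⟨ cong (λ m → 2 * (𝓑 (a + a) 0 * 𝓑 m 0)) ([k+k]∸[a+a]∸1 a<k) ⟩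
      2 * (𝓑 (a + a) 0 * 𝓑 (suc (d + d)) 0)           ≡⟨ x∙yz≈y∙xz 2 (𝓑 (a + a) 0) (𝓑 (suc (d + d)) 0) ⟩
      𝓑 (a + a) 0 * (2 * 𝓑 (suc (d + d)) 0)           ≡⟨ cong₂ _*_ (𝓑-even a) (𝓑-odd d) ⟩
      central a * central (suc d)                      ≡⟨ cong (λ m → central a * central m) (1+[k∸[1+a]]≡k∸a a<k) ⟩
      central a * central (k ∸ a)                      ∎
      where d = k ∸ suc a
    odd-term : ∀ {a} → a < k → 2 * odds a ≡ back a
    odd-term {a} a<k = begin
      2 * (𝓑 (suc (a + a)) 0 * 𝓑 ((k + k) ∸ suc (a + a) ∸ 1) 0)
        ≡⟨ cong (λ m → 2 * (𝓑 (suc (a + a)) 0 * 𝓑 m 0)) ([k+k]∸[1+a+a]∸1 a<k) ⟩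
      2 * (𝓑 (suc (a + a)) 0 * 𝓑 (d + d) 0)           ≡⟨ *-assoc 2 (𝓑 (suc (a + a)) 0) (𝓑 (d + d) 0) ⟨
      2 * 𝓑 (suc (a + a)) 0 * 𝓑 (d + d) 0             ≡⟨ cong₂ _*_ (𝓑-odd a) (𝓑-even d) ⟩
      central (suc a) * central d                      ∎
      where d = k ∸ suc a
    distribute : ∀ b u v → 2 * (b + (u + v)) ≡ 2 * b + (2 * u + 2 * v)
    distribute = solve-∀
    rearrange : ∀ c u v → 2 * c + (u + v) ≡ (u + c) + (c + v)
    rearrange = solve-∀

  𝓑+𝓑-conv-odd : ∀ k → 𝓑 (suc (k + k)) 0 + 𝓑-conv (suc (k + k)) ≡ 2 ^ suc (k + k)
  𝓑+𝓑-conv-odd k = *-cancelˡ-≡ _ _ 4 (begin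
    4 * (𝓑 n 0 + 𝓑-conv n)                            ≡⟨ cong (λ z → 4 * (𝓑 n 0 + z)) (Σ<-parity-suc k f) ⟩
    4 * (𝓑 n 0 + (Σ< (suc k) evens + Σ< k odds))     ≡⟨ distribute (𝓑 n 0) (Σ< (suc k) evens) (Σ< k odds) ⟩
    2 * (2 * 𝓑 n 0) + (4 * Σ< (suc k) evens + 4 * Σ< k odds)
      ≡⟨ cong₂ (λ u v → 2 * u + v) (𝓑-odd k)
           (cong₂ (λ u v → 4 * u + v) (Σ<-cong (suc k) (λ a → even-term))
                                       (Σ<-*ˡ-cong k 4 {odds} (λ a → odd-term))) ⟩
    2 * central (suc k) + (4 * σ k + Σ< k shifted)    ≡⟨ rearrange (central (suc k)) (σ k) (Σ< k shifted) ⟩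
    4 * σ k + (central (suc k) + (Σ< k shifted + central (suc k)))
                                                       ≡⟨ cong (λ z → 4 * σ k + (central (suc k) + z))
                                                               (Σ<-last-central k (λ a → central (suc a))) ⟨
    4 * σ k + (central (suc k) + Σ< (suc k) shifted)  ≡⟨ cong (4 * σ k +_) (σ-head (suc k)) ⟨
    4 * σ k + σ (suc k)                               ≡⟨ cong (4 * σ k +_) (σ-suc k) ⟩
    4 * σ k + 4 * σ k                                 ≡⟨ cong (λ s → 4 * s + 4 * s) (trans (σ≡4^k k) (4^k≡2^[k+k] k)) ⟩
    4 * 2 ^ (k + k) + 4 * 2 ^ (k + k)                 ≡⟨ double (2 ^ (k + k)) ⟩
    4 * (2 * 2 ^ (k + k))                             ∎)
    where
    n : ℕ
    n = suc (k + k)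
    f : ℕ → ℕ
    f j = 𝓑 j 0 * 𝓑 (n ∸ j ∸ 1) 0
    evens odds shifted : ℕ → ℕ
    evens a = f (a + a)
    odds a = f (suc (a + a))
    shifted a = central (suc a) * central (k ∸ a)
    even-term : ∀ {a} → a < suc k → evens a ≡ central a * central (k ∸ a)
    even-term {a} (s≤s a≤k) = begin
      𝓑 (a + a) 0 * 𝓑 (n ∸ (a + a) ∸ 1) 0             ≡⟨ cong (λ m → 𝓑 (a + a) 0 * 𝓑 m 0) ([1+k+k]∸[a+a]∸1 a≤k) ⟩
      𝓑 (a + a) 0 * 𝓑 ((k ∸ a) + (k ∸ a)) 0           ≡⟨ cong₂ _*_ (𝓑-even a) (𝓑-even (k ∸ a)) ⟩
      central a * central (k ∸ a)                      ∎
    odd-term : ∀ {a} → a < k → 4 * odds a ≡ shifted a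
    odd-term {a} a<k = begin
      4 * (𝓑 (suc (a + a)) 0 * 𝓑 ((k + k) ∸ (a + a) ∸ 1) 0)
        ≡⟨ cong (λ m → 4 * (𝓑 (suc (a + a)) 0 * 𝓑 m 0)) ([k+k]∸[a+a]∸1 a<k) ⟩
      4 * (𝓑 (suc (a + a)) 0 * 𝓑 (suc (d + d)) 0)     ≡⟨ split (𝓑 (suc (a + a)) 0) (𝓑 (suc (d + d)) 0) ⟩
      2 * 𝓑 (suc (a + a)) 0 * (2 * 𝓑 (suc (d + d)) 0) ≡⟨ cong₂ _*_ (𝓑-odd a) (𝓑-odd d) ⟩
      central (suc a) * central (suc d)                ≡⟨ cong (λ m → central (suc a) * central m) (1+[k∸[1+a]]≡k∸a a<k) ⟩
      central (suc a) * central (k ∸ a)                ∎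
      where
      d = k ∸ suc a
      split : ∀ p q → 4 * (p * q) ≡ 2 * p * (2 * q)
      split = solve-∀
    distribute : ∀ b u v → 4 * (b + (u + v)) ≡ 2 * (2 * b) + (4 * u + 4 * v)
    distribute = solve-∀
    rearrange : ∀ c s u → 2 * c + (4 * s + u) ≡ 4 * s + (c + (u + c))
    rearrange = solve-∀
    double : ∀ p → 4 * p + 4 * p ≡ 4 * (2 * p)
    double = solve-∀

  data ParityView : ℕ → Set where
    even : ∀ k → ParityView (k + k)
    odd  : ∀ k → ParityView (suc (k + k))

  parityView : ∀ n → ParityView n
  parityView zero = even 0
  parityView (suc n) with parityView n
  ... | even k = odd k
  ... | odd k  = subst ParityView (cong suc (+-suc k k)) (even (suc k))

  𝓑+𝓑-conv≡2^n : ∀ n → 𝓑 n 0 + 𝓑-conv n ≡ 2 ^ n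
  𝓑+𝓑-conv≡2^n n with parityView n
  ... | even k = 𝓑+𝓑-conv-even k
  ... | odd k  = 𝓑+𝓑-conv-odd k

module Recurrence {r ℓ} (R : CommutativeRing r ℓ) (x : CommutativeRing.Carrier R) where

  open import Data.Nat using (_∸_; ⌊_/2⌋)
  open import Data.Nat.Combinatorics using (_C_; nCk+nC[k+1]≡[n+1]C[k+1])
  open CommutativeRing R
  open Poly R using (P; RHS)
  open IndexedSum commutativeSemiring
  open IndexedSum ℕₚ.+-*-commutativeSemiring using () renaming (Σ< to Σℕ<)
  open BinomialConvolution using (𝓑-sym; ∸-suc; 𝓑-conv; 𝓑+𝓑-conv≡2^n)
  open import Algebra.Properties.Semiring.Exp semiring using (_^_; ^-congˡ; ^-congʳ; ^-homo-*)
  open import Algebra.Properties.CommutativeSemiring.Exp commutativeSemiring using (^-distrib-*)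
  open import Algebra.Properties.Monoid.Mult +-monoid using (_×_; ×-congˡ; ×-homo-+)
  open import Algebra.Properties.Semiring.Mult semiring using (×1-homo-*)
  open import Algebra.Properties.AbelianGroup +-abelianGroup using (xyx⁻¹≈y)
  open import Algebra.Solver.Ring.NaturalCoefficients.Default commutativeSemiring
  open import Relation.Binary.Reasoning.Setoid setoid

  [_] : ℕ → Carrier
  [ k ] = k × 1#

  ×1-homo-^ : ∀ m n → [ m ℕ.^ n ] ≈ [ m ] ^ n
  ×1-homo-^ m zero    = +-identityʳ 1#
  ×1-homo-^ m (suc n) = trans (×1-homo-* m (m ℕ.^ n)) (*-congˡ (×1-homo-^ m n))

  ×1-homo-Σ< : ∀ n f → [ Σℕ< n f ] ≈ Σ< n (λ i → [ f i ])
  ×1-homo-Σ< zero    f = refl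
  ×1-homo-Σ< (suc n) f = trans (×-homo-+ 1# (f 0) _) (+-congˡ (×1-homo-Σ< n (λ i → f (suc i))))

  y : Carrier
  y = 1# - x

  x+y≈1 : x + y ≈ 1#
  x+y≈1 = trans (sym (+-assoc x 1# (- x))) (xyx⁻¹≈y x 1#)

  -- The solver below works in the underlying semiring, where 1 − x is opaque; identities involving y
  -- are first made homogeneous by inserting factors x + y ≈ 1.
  homogenise : ∀ a → a ≈ a * (x + y)
  homogenise a = sym (trans (*-congˡ x+y≈1) (*-identityʳ a))

  term : ℕ → ℕ → Carrier
  term n m = [ n C ⌊ m /2⌋ ] * x ^ m

  P≈Σ<-term : ∀ n → P n x ≈ Σ< (suc n) (term n)
  P≈Σ<-term n = Σ<-reverse n (term n)

  P-zero : P 0 x ≈ 1#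
  P-zero = trans (+-identityʳ _) (trans (*-identityʳ _) (+-identityʳ 1#))

  term-suc : ∀ n m → term (suc n) (suc (suc m)) ≈ term n (suc (suc m)) + x * x * term n m
  term-suc n m = begin
    [ suc n C suc h ] * x ^ suc (suc m)
      ≈⟨ *-congʳ (×-congˡ (≡.sym (nCk+nC[k+1]≡[n+1]C[k+1] n h))) ⟩
    [ n C h ℕ.+ n C suc h ] * x ^ suc (suc m)
      ≈⟨ *-congʳ (×-homo-+ 1# (n C h) (n C suc h)) ⟩
    ([ n C h ] + [ n C suc h ]) * (x * (x * x ^ m))
      ≈⟨ solve 4 (λ A B X E → (A :+ B) :* (X :* (X :* E)) := B :* (X :* (X :* E)) :+ X :* X :* (A :* E))
               refl [ n C h ] [ n C suc h ] x (x ^ m) ⟩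
    term n (suc (suc m)) + x * x * term n m
      ∎
    where
    h : ℕ
    h = ⌊ m /2⌋

  Σ<-term-suc : ∀ n → Σ< (suc (suc n)) (term (suc n)) ≈ Σ< (suc (suc n)) (term n) + x * x * Σ< n (term n)
  Σ<-term-suc n = begin
    term n 0 + (term n 1 + Σ< n (λ m → term (suc n) (suc (suc m))))
      ≈⟨ +-congˡ (+-congˡ (Σ<-cong n (λ m _ → term-suc n m))) ⟩
    term n 0 + (term n 1 + Σ< n (λ m → term n (suc (suc m)) + x * x * term n m))
      ≈⟨ +-congˡ (+-congˡ (trans (Σ<-+ n (λ m → term n (suc (suc m))) (λ m → x * x * term n m))
                                 (+-congˡ (Σ<-*ˡ n (x * x) (term n))))) ⟩
    term n 0 + (term n 1 + (Σ< n (λ m → term n (suc (suc m))) + x * x * Σ< n (term n)))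
      ≈⟨ +-congˡ (sym (+-assoc _ _ _)) ⟩
    term n 0 + (Σ< (suc n) (λ m → term n (suc m)) + x * x * Σ< n (term n))
      ≈⟨ sym (+-assoc _ _ _) ⟩
    Σ< (suc (suc n)) (term n) + x * x * Σ< n (term n)
      ∎

  P-suc : ∀ n → P (suc n) x ≈ (1# + x * x) * P n x + [ 𝓑 n 0 ] * x ^ suc n * y
  P-suc n = begin
    P (suc n) x                                           ≈⟨ P≈Σ<-term (suc n) ⟩
    Σ< (suc (suc n)) (term (suc n))                       ≈⟨ Σ<-term-suc n ⟩
    Σ< (suc (suc n)) (term n) + x * x * Z                 ≈⟨ +-congʳ (Σ<-last (suc n) (term n)) ⟩
    Σ< (suc n) (term n) + term n (suc n) + x * x * Z
      ≈⟨ +-congʳ (+-cong (Σ<-last n (term n)) (*-congʳ (×-congˡ (𝓑-sym n)))) ⟩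
    Z + b * E + b * (x * E) + x * x * Z                   ≈⟨ +-congʳ (+-congˡ (homogenise (b * (x * E)))) ⟩
    Z + b * E + b * (x * E) * (x + y) + x * x * Z
      ≈⟨ solve 5 (λ Z B E X Y → Z :+ B :* E :+ B :* (X :* E) :* (X :+ Y) :+ X :* X :* Z
                               := (con 1 :+ X :* X) :* (Z :+ B :* E) :+ B :* (X :* E) :* Y) refl Z b E x y ⟩
    (1# + x * x) * (Z + b * E) + b * (x * E) * y         ≈⟨ +-congʳ (*-congˡ (trans (P≈Σ<-term n) (Σ<-last n (term n)))) ⟨
    (1# + x * x) * P n x + b * x ^ suc n * y              ∎
    where
    Z b E : Carrier
    Z = Σ< n (term n)
    b = [ 𝓑 n 0 ]
    E = x ^ n

  W : ℕ → Carrier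
  W n = Σ< n (λ j → [ 𝓑 (n ∸ j ∸ 1) 0 ] * P j x * x ^ (n ∸ j ∸ 1))

  W-suc : ∀ n → W (suc n) ≈ [ 𝓑 n 0 ] * x ^ n + ((1# + x * x) * W n + y * (x ^ n * [ 𝓑-conv n ]))
  W-suc n = +-cong (*-congʳ (trans (*-congˡ P-zero) (*-identityʳ _))) (begin
    Σ< n (λ j → [ 𝓑 (e j) 0 ] * P (suc j) x * x ^ e j)
      ≈⟨ Σ<-cong n step ⟩
    Σ< n (λ j → (1# + x * x) * w j + y * (x ^ n * v j))
      ≈⟨ Σ<-+ n (λ j → (1# + x * x) * w j) (λ j → y * (x ^ n * v j)) ⟩
    Σ< n (λ j → (1# + x * x) * w j) + Σ< n (λ j → y * (x ^ n * v j))
      ≈⟨ +-cong (Σ<-*ˡ n (1# + x * x) w)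
                (trans (Σ<-*ˡ n y (λ j → x ^ n * v j)) (*-congˡ (Σ<-*ˡ n (x ^ n) v))) ⟩
    (1# + x * x) * W n + y * (x ^ n * Σ< n v)
      ≈⟨ +-congˡ (*-congˡ (*-congˡ (×1-homo-Σ< n (λ j → 𝓑 j 0 ℕ.* 𝓑 (e j) 0)))) ⟨
    (1# + x * x) * W n + y * (x ^ n * [ 𝓑-conv n ])
      ∎)
    where
    e : ℕ → ℕ
    e j = n ∸ j ∸ 1
    w v : ℕ → Carrier
    w j = [ 𝓑 (e j) 0 ] * P j x * x ^ e j
    v j = [ 𝓑 j 0 ℕ.* 𝓑 (e j) 0 ]
    x^n≈x^[1+j]*x^e : ∀ {j} → j ℕ.< n → x ^ n ≈ x ^ suc j * x ^ e j
    x^n≈x^[1+j]*x^e {j} j<n =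
      trans (^-congʳ x (≡.sym (≡.trans (≡.cong (suc j ℕ.+_) (∸-suc n j)) (ℕₚ.m+[n∸m]≡n j<n))))
            (^-homo-* x (suc j) (e j))
    step : ∀ j → j ℕ.< n → [ 𝓑 (e j) 0 ] * P (suc j) x * x ^ e j ≈ (1# + x * x) * w j + y * (x ^ n * v j)
    step j j<n = begin
      b * P (suc j) x * E                                     ≈⟨ *-congʳ (*-congˡ (P-suc j)) ⟩
      b * ((1# + x * x) * P j x + c * x ^ suc j * y) * E
        ≈⟨ solve 7 (λ B Pj C A E X Y → B :* ((con 1 :+ X :* X) :* Pj :+ C :* A :* Y) :* E
                                     := (con 1 :+ X :* X) :* (B :* Pj :* E) :+ Y :* (A :* E :* (C :* B)))
                 refl b (P j x) c (x ^ suc j) E x y ⟩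
      (1# + x * x) * w j + y * (x ^ suc j * E * (c * b))
        ≈⟨ +-congˡ (*-congˡ (*-cong (x^n≈x^[1+j]*x^e j<n) (×1-homo-* (𝓑 j 0) (𝓑 (e j) 0)))) ⟨
      (1# + x * x) * w j + y * (x ^ n * v j)                   ∎
      where
      b c E : Carrier
      b = [ 𝓑 (e j) 0 ]
      c = [ 𝓑 j 0 ]
      E = x ^ e j

  [2x]^n≈[𝓑+𝓑-conv]*x^n : ∀ n → ((1# + 1#) * x) ^ n ≈ ([ 𝓑 n 0 ] + [ 𝓑-conv n ]) * x ^ n
  [2x]^n≈[𝓑+𝓑-conv]*x^n n = begin
    ((1# + 1#) * x) ^ n                      ≈⟨ ^-distrib-* (1# + 1#) x n ⟩
    (1# + 1#) ^ n * x ^ n                    ≈⟨ *-congʳ (^-congˡ n (+-congˡ (+-identityʳ 1#))) ⟨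
    [ 2 ] ^ n * x ^ n                        ≈⟨ *-congʳ (×1-homo-^ 2 n) ⟨
    [ 2 ℕ.^ n ] * x ^ n                      ≈⟨ *-congʳ (×-congˡ (𝓑+𝓑-conv≡2^n n)) ⟨
    [ 𝓑 n 0 ℕ.+ 𝓑-conv n ] * x ^ n           ≈⟨ *-congʳ (×-homo-+ 1# (𝓑 n 0) (𝓑-conv n)) ⟩
    ([ 𝓑 n 0 ] + [ 𝓑-conv n ]) * x ^ n       ∎

  [x+y]²≈1 : (x + y) * (x + y) ≈ 1#
  [x+y]²≈1 = trans (*-cong x+y≈1 x+y≈1) (*-identityʳ 1#)

  2x+y≈1+x²+xy : (1# + 1#) * x + y ≈ 1# + x * x + x * y
  2x+y≈1+x²+xy = begin
    (1# + 1#) * x + y                     ≈⟨ homogenise _ ⟩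
    ((1# + 1#) * x + y) * (x + y)         ≈⟨ solve 2 (λ X Y → (con 2 :* X :+ Y) :* (X :+ Y)
                                                          := (X :+ Y) :* (X :+ Y) :+ X :* X :+ X :* Y) refl x y ⟩
    (x + y) * (x + y) + x * x + x * y     ≈⟨ +-congʳ (+-congʳ [x+y]²≈1) ⟩
    1# + x * x + x * y                    ∎

  2x+y²≈1+x² : (1# + 1#) * x + y * y ≈ 1# + x * x
  2x+y²≈1+x² = begin
    (1# + 1#) * x + y * y                 ≈⟨ +-congʳ (homogenise _) ⟩
    (1# + 1#) * x * (x + y) + y * y       ≈⟨ solve 2 (λ X Y → con 2 :* X :* (X :+ Y) :+ Y :* Y
                                                          := (X :+ Y) :* (X :+ Y) :+ X :* X) refl x y ⟩
    (x + y) * (x + y) + x * x             ≈⟨ +-congʳ [x+y]²≈1 ⟩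
    1# + x * x                            ∎

  RHS-zero : RHS 0 x ≈ 1#
  RHS-zero = trans (+-congˡ (zeroʳ y)) (+-identityʳ 1#)

  RHS-suc : ∀ n → RHS (suc n) x ≈ (1# + x * x) * RHS n x + [ 𝓑 n 0 ] * x ^ suc n * y
  RHS-suc n = begin
    (1# + 1#) * x * ((1# + 1#) * x) ^ n + y * W (suc n)
      ≈⟨ +-cong (*-congˡ ([2x]^n≈[𝓑+𝓑-conv]*x^n n)) (*-congˡ (W-suc n)) ⟩
    (1# + 1#) * x * ((b + s) * E) + y * (b * E + ((1# + x * x) * W n + y * (E * s)))
      ≈⟨ solve 6 (λ X Y B S E V →
                   con 2 :* X :* ((B :+ S) :* E) :+ Y :* (B :* E :+ ((con 1 :+ X :* X) :* V :+ Y :* (E :* S)))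
                := (con 1 :+ X :* X) :* (Y :* V) :+ E :* (B :* (con 2 :* X :+ Y) :+ S :* (con 2 :* X :+ Y :* Y)))
               refl x y b s E (W n) ⟩
    (1# + x * x) * (y * W n) + E * (b * ((1# + 1#) * x + y) + s * ((1# + 1#) * x + y * y))
      ≈⟨ +-congˡ (*-congˡ (+-cong (*-congˡ 2x+y≈1+x²+xy) (*-congˡ 2x+y²≈1+x²))) ⟩
    (1# + x * x) * (y * W n) + E * (b * (1# + x * x + x * y) + s * (1# + x * x))
      ≈⟨ solve 6 (λ X Y B S E V →
                   (con 1 :+ X :* X) :* (Y :* V) :+ E :* (B :* (con 1 :+ X :* X :+ X :* Y) :+ S :* (con 1 :+ X :* X))
                := (con 1 :+ X :* X) :* ((B :+ S) :* E :+ Y :* V) :+ B :* (X :* E) :* Y)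
               refl x y b s E (W n) ⟩
    (1# + x * x) * ((b + s) * E + y * W n) + b * (x * E) * y
      ≈⟨ +-congʳ (*-congˡ (+-congʳ ([2x]^n≈[𝓑+𝓑-conv]*x^n n))) ⟨
    (1# + x * x) * RHS n x + b * x ^ suc n * y
      ∎
    where
    b s E : Carrier
    b = [ 𝓑 n 0 ]
    s = [ 𝓑-conv n ]
    E = x ^ n

theorem3p5 : {c ℓ : Level} (R : CommutativeRing c ℓ) (n : ℕ) (x : CommutativeRing.Carrier R) →
    CommutativeRing._≈_ R (Poly.P R n x) (Poly.RHS R n x)
theorem3p5 R n x = P≈RHS n
  where
  open CommutativeRing R
  open Poly R using (P; RHS)
  open Recurrence R x

  P≈RHS : ∀ n → P n x ≈ RHS n x
  P≈RHS zero    = trans P-zero (sym RHS-zero)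
  P≈RHS (suc n) = trans (P-suc n) (trans (+-congʳ (*-congˡ (P≈RHS n))) (sym (RHS-suc n)))
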